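{- In $LET_K^+$ the following rules are derivable: (Cons) for all formulas $A,B$, $\circ A,\neg\circ A\vdash_{LET_K^+} B$; (Comp) for every set of formulas $\Gamma$ and formulas $A,B$, if $\Gamma,\circ A\vdash_{LET_K^+}B$ and $\Gamma,\neg\circ A\vdash_{LET_K^+}B$, then $\Gamma\vdash_{LET_K^+}B$.
   Context: Formulas are built from a denumerable set of propositional variables over $\Sigma=\{\land,\lor,\to,\neg,\circ\}$. The logic $LET_K$ is the natural deduction system with rules: ($\land$I) from $A,B$ infer $A\land B$; ($\land$E) from $A\land B$ infer $A$ and $B$; ($\lor$I) from $A$ (or from $B$) infer $A\lor B$; ($\lor$E) from $A\lor B$ and derivations of $C$ from $[A]$ and from $[B]$ infer $C$; ($\neg\land$I) from $\neg A$ (or $\neg B$) infer $\neg(A\land B)$; ($\neg\land$E) from $\neg(A\land B)$ and derivations of $C$ from $[\neg A]$ and from $[\neg B]$ infer $C$; ($\neg\lor$I) from $\neg A,\neg B$ infer $\neg(A\lor B)$; ($\neg\lor$E) from $\neg(A\lor B)$ infer $\neg A$ and $\neg B$; (DN) $A$ and $\neg\neg A$ are inter-derivable; ($\to$I) from a derivation of $B$ from $[A]$ infer $A\to B$; ($\to$E) from $A\to B$ and $A$ infer $B$; ($\to_{CL}$) axiom $A\lor(A\to B)$; ($\neg\to$I) from $A,\neg B$ infer $\neg(A\to B)$; ($\neg\to$E) from $\neg(A\to B)$ infer $A$ and $\neg B$; (EXP$^\circ$) from $\circ A,A,\neg A$ infer $B$; (PEM$^\circ$) from $\circ A$ infer $A\lor\neg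 A$. Bracketed hypotheses are discharged. Write $A^T$ for $\circ A\land A$ and $A^F$ for $\circ A\land\neg A$. $LET_K^+$ is obtained by adding to $LET_K$: (I$\circ$) axiom $\circ\circ A$; (I$\neg\circ$) from $\circ A$ infer $\circ\neg A$; (E$\neg\circ$) from $\circ\neg A$ infer $\circ A$; (I$\land$T) from $A^T,B^T$ infer $(A\land B)^T$; (I$\land$F) from $A^F$ (or from $B^F$) infer $(A\land B)^F$; (I$\lor$T) from $A^T$ (or from $B^T$) infer $(A\lor B)^T$; (I$\lor$F) from $A^F,B^F$ infer $(A\lor B)^F$; (I$\to$T) from $A^F$ (or from $B^T$) infer $(A\to B)^T$; (I$\to$F) from $A$ and $B^F$ infer $(A\to B)^F$; (E$\land$T) from $(A\land B)^T$ infer $A^T$ and $B^T$; (E$\land$F) from $(A\land B)^F$ and derivations of $C$ from $[A^F]$ and from $[B^F]$ infer $C$; (E$\lor$T) from $(A\lor B)^T$ and derivations of $C$ from $[A^T]$ and from $[B^T]$ infer $C$; (E$\lor$F) from $(A\lor B)^F$ infer $A^F$ and $B^F$; (E$\to$T) from $(A\to B)^T$ and derivations of $C$ from $[A^F]$ and from $[B^T]$ infer $C$; (E$\to$F) from $(A\to B)^F$ infer $A$ and $B^F$. $\Gamma\vdash_{LET_K^+}A$ means $A$ is derivable from premises in $\Gamma$. -}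

module Defs where

open import Data.Nat using (ℕ)
open import Data.Sum using (_⊎_)
open import Relation.Binary.PropositionalEquality using (_≡_)
open import Level using (Level; suc; 0ℓ)

infixr 6 _∧_
infixr 5 _∨_
infixr 4 _⇒_
infix 8 ¬_ ∘_
infix 9 _ᵀ _ᶠ
infixl 1 _,,_

data Formula : Set where
  var : ℕ → Formula
  _∧_ : Formula → Formula → Formula
  _∨_ : Formula → Formula → Formula
  _⇒_ : Formula → Formula → Formula
  ¬_  : Formula → Formula
  ∘_  : Formula → Formula

_ᵀ : Formula → Formula
A ᵀ = (∘ A) ∧ A

_ᶠ : Formula → Formula
A ᶠ = (∘ A) ∧ (¬ A)

Ctx : Set₁
Ctx = Formula → Set

_,,_ : Ctx → Formula → Ctx
(Γ ,, A) B = Γ B ⊎ B ≡ A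

-- Derivability in LET_K^+ from premises in Γ (natural deduction, with
-- discharged hypotheses represented by extending the set of open assumptions).
infix 0 _⊢_
data _⊢_ (Γ : Ctx) : Formula → Set₁ where
  hyp   : ∀ {A} → Γ A → Γ ⊢ A
  -- LET_K
  ∧I    : ∀ {A B} → Γ ⊢ A → Γ ⊢ B → Γ ⊢ A ∧ B
  ∧E₁   : ∀ {A B} → Γ ⊢ A ∧ B → Γ ⊢ A
  ∧E₂   : ∀ {A B} → Γ ⊢ A ∧ B → Γ ⊢ B
  ∨I₁   : ∀ {A B} → Γ ⊢ A → Γ ⊢ A ∨ B
  ∨I₂   : ∀ {A B} → Γ ⊢ B → Γ ⊢ A ∨ B
  ∨E    : ∀ {A B C} → Γ ⊢ A ∨ B → (Γ ,, A) ⊢ C → (Γ ,, B) ⊢ C → Γ ⊢ C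
  ¬∧I₁  : ∀ {A B} → Γ ⊢ ¬ A → Γ ⊢ ¬ (A ∧ B)
  ¬∧I₂  : ∀ {A B} → Γ ⊢ ¬ B → Γ ⊢ ¬ (A ∧ B)
  ¬∧E   : ∀ {A B C} → Γ ⊢ ¬ (A ∧ B) → (Γ ,, ¬ A) ⊢ C → (Γ ,, ¬ B) ⊢ C → Γ ⊢ C
  ¬∨I   : ∀ {A B} → Γ ⊢ ¬ A → Γ ⊢ ¬ B → Γ ⊢ ¬ (A ∨ B)
  ¬∨E₁  : ∀ {A B} → Γ ⊢ ¬ (A ∨ B) → Γ ⊢ ¬ A
  ¬∨E₂  : ∀ {A B} → Γ ⊢ ¬ (A ∨ B) → Γ ⊢ ¬ B
  DNI   : ∀ {A} → Γ ⊢ A → Γ ⊢ ¬ (¬ A)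
  DNE   : ∀ {A} → Γ ⊢ ¬ (¬ A) → Γ ⊢ A
  ⇒I    : ∀ {A B} → (Γ ,, A) ⊢ B → Γ ⊢ A ⇒ B
  ⇒E    : ∀ {A B} → Γ ⊢ A ⇒ B → Γ ⊢ A → Γ ⊢ B
  ⇒CL   : ∀ {A B} → Γ ⊢ A ∨ (A ⇒ B)
  ¬⇒I   : ∀ {A B} → Γ ⊢ A → Γ ⊢ ¬ B → Γ ⊢ ¬ (A ⇒ B)
  ¬⇒E₁  : ∀ {A B} → Γ ⊢ ¬ (A ⇒ B) → Γ ⊢ A
  ¬⇒E₂  : ∀ {A B} → Γ ⊢ ¬ (A ⇒ B) → Γ ⊢ ¬ B
  EXP∘  : ∀ {A B} → Γ ⊢ ∘ A → Γ ⊢ A → Γ ⊢ ¬ A → Γ ⊢ B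
  PEM∘  : ∀ {A} → Γ ⊢ ∘ A → Γ ⊢ A ∨ ¬ A
  -- additional rules of LET_K^+
  I∘    : ∀ {A} → Γ ⊢ ∘ (∘ A)
  I¬∘   : ∀ {A} → Γ ⊢ ∘ A → Γ ⊢ ∘ (¬ A)
  E¬∘   : ∀ {A} → Γ ⊢ ∘ (¬ A) → Γ ⊢ ∘ A
  I∧T   : ∀ {A B} → Γ ⊢ A ᵀ → Γ ⊢ B ᵀ → Γ ⊢ (A ∧ B) ᵀ
  I∧F₁  : ∀ {A B} → Γ ⊢ A ᶠ → Γ ⊢ (A ∧ B) ᶠ
  I∧F₂  : ∀ {A B} → Γ ⊢ B ᶠ → Γ ⊢ (A ∧ B) ᶠ
  I∨T₁  : ∀ {A B} → Γ ⊢ A ᵀ → Γ ⊢ (A ∨ B) ᵀ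
  I∨T₂  : ∀ {A B} → Γ ⊢ B ᵀ → Γ ⊢ (A ∨ B) ᵀ
  I∨F   : ∀ {A B} → Γ ⊢ A ᶠ → Γ ⊢ B ᶠ → Γ ⊢ (A ∨ B) ᶠ
  I⇒T₁  : ∀ {A B} → Γ ⊢ A ᶠ → Γ ⊢ (A ⇒ B) ᵀ
  I⇒T₂  : ∀ {A B} → Γ ⊢ B ᵀ → Γ ⊢ (A ⇒ B) ᵀ
  I⇒F   : ∀ {A B} → Γ ⊢ A → Γ ⊢ B ᶠ → Γ ⊢ (A ⇒ B) ᶠ
  E∧T₁  : ∀ {A B} → Γ ⊢ (A ∧ B) ᵀ → Γ ⊢ A ᵀ
  E∧T₂  : ∀ {A B} → Γ ⊢ (A ∧ B) ᵀ → Γ ⊢ B ᵀ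
  E∧F   : ∀ {A B C} → Γ ⊢ (A ∧ B) ᶠ → (Γ ,, A ᶠ) ⊢ C → (Γ ,, B ᶠ) ⊢ C → Γ ⊢ C
  E∨T   : ∀ {A B C} → Γ ⊢ (A ∨ B) ᵀ → (Γ ,, A ᵀ) ⊢ C → (Γ ,, B ᵀ) ⊢ C → Γ ⊢ C
  E∨F₁  : ∀ {A B} → Γ ⊢ (A ∨ B) ᶠ → Γ ⊢ A ᶠ
  E∨F₂  : ∀ {A B} → Γ ⊢ (A ∨ B) ᶠ → Γ ⊢ B ᶠ
  E⇒T   : ∀ {A B C} → Γ ⊢ (A ⇒ B) ᵀ → (Γ ,, A ᶠ) ⊢ C → (Γ ,, B ᵀ) ⊢ C → Γ ⊢ C
  E⇒F₁  : ∀ {A B} → Γ ⊢ (A ⇒ B) ᶠ → Γ ⊢ A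
  E⇒F₂  : ∀ {A B} → Γ ⊢ (A ⇒ B) ᶠ → Γ ⊢ B ᶠ

⟨_,_⟩ : Formula → Formula → Ctx
⟨ A , B ⟩ C = C ≡ A ⊎ C ≡ B

{-# OPTIONS --safe #-}
module Submission where

open import Defs
open import Data.Product using (_×_; _,_)
open import Data.Sum using (inj₁; inj₂)
open import Relation.Binary.PropositionalEquality using (refl)

-- Both rules come from the axiom ∘∘A: the formula ∘A is itself classical,
-- so explosion and excluded middle apply to it.

∘-explosion : ∀ {Γ A B} → Γ ⊢ ∘ A → Γ ⊢ ¬ (∘ A) → Γ ⊢ B
∘-explosion = EXP∘ I∘

∘-cases : ∀ {Γ A B} → (Γ ,, ∘ A) ⊢ B → (Γ ,, ¬ (∘ A)) ⊢ B → Γ ⊢ B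
∘-cases {A = A} = ∨E (PEM∘ (I∘ {A = A}))

proposition3p3 : ((A B : Formula) → ⟨ ∘ A , ¬ (∘ A) ⟩ ⊢ B)
    × ((Γ : Ctx) (A B : Formula) → (Γ ,, ∘ A) ⊢ B → (Γ ,, ¬ (∘ A)) ⊢ B → Γ ⊢ B)
proposition3p3 =
  (λ A B → ∘-explosion (hyp (inj₁ refl)) (hyp (inj₂ refl))) ,
  (λ Γ A B → ∘-cases)
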